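{- Let $T,S$ be pruned trees on $\mathbb{N}$ and let $\Phi\colon[T]\to[S]$ be a uniform homeomorphism. If both $[T]$ and $[S]$ are uncountable, then $\Omega_\Phi$ and $\Omega_{\Phi^{ -1}}$ are unbounded monotone functions from $\mathbb{N}$ to $\mathbb{N}$.
   Context: A tree on $\mathbb{N}$ is a nonempty $T\subseteq\mathbb{N}^{<\mathbb{N}}$ closed under initial segments; pruned means every node has a proper extension in $T$. $[T]$ is the set of $x\in\mathbb{N}^{\mathbb{N}}$ with all initial segments in $T$, with ultrametric $d(x,y)=2^{ -n}$, $n$ least with $x(n)\ne y(n)$. A uniform homeomorphism is a bijection which together with its inverse is uniformly continuous. For a uniformly continuous $\Phi\colon[T]\to[S]$, $\Omega_\Phi(n)$ denotes the least $m\in\mathbb{N}$ such that for all $x,y\in[T]$, $x\upharpoonright m=y\upharpoonright m$ implies $\Phi(x)\upharpoonright n=\Phi(y)\upharpoonright n$ (such $m$ exists by uniform continuity); $\Omega_{\Phi^{ -1}}$ is defined analogously for $\Phi^{ -1}\colon[S]\to[T]$. -}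

module Defs where

open import Data.Nat using (ℕ; _≤_)
open import Data.List using (List; []; _∷_; _++_; map; upTo)
open import Data.Product using (Σ; ∃; ∃-syntax; _×_; proj₁)
open import Relation.Nullary using (¬_)
open import Relation.Binary.PropositionalEquality using (_≡_)

Pred : Set₁
Pred = List ℕ → Set

-- T is a tree: nonempty (contains the empty sequence, which follows from
-- nonemptiness + closure) and closed under initial segments.
IsTree : Pred → Set
IsTree T = T [] × (∀ (s t : List ℕ) → T (s ++ t) → T s)

Pruned : Pred → Set
Pruned T = ∀ (s : List ℕ) → T s → ∃[ t ] (¬ (t ≡ []) × T (s ++ t))

_↾_ : (ℕ → ℕ) → ℕ → List ℕ
x ↾ n = map x (upTo n)

Branch : Pred → Set
Branch T = Σ (ℕ → ℕ) (λ x → ∀ (n : ℕ) → T (x ↾ n))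

BranchEq : (T : Pred) → Branch T → Branch T → Set
BranchEq T x y = ∀ (i : ℕ) → proj₁ x i ≡ proj₁ y i

Countable : Pred → Set
Countable T = Σ (Branch T → ℕ) (λ g → ∀ (x y : Branch T) → g x ≡ g y → BranchEq T x y)

Uncountable : Pred → Set
Uncountable T = ¬ Countable T

IsModulus : (T S : Pred) → (Branch T → Branch S) → ℕ → ℕ → Set
IsModulus T S Φ n m = ∀ (x y : Branch T) → proj₁ x ↾ m ≡ proj₁ y ↾ m
                        → proj₁ (Φ x) ↾ n ≡ proj₁ (Φ y) ↾ n

-- Uniform continuity (w.r.t. the ultrametric d(x,y) = 2^{-n}).
UniformlyContinuous : (T S : Pred) → (Branch T → Branch S) → Set
UniformlyContinuous T S Φ = ∀ (n : ℕ) → ∃[ m ] IsModulus T S Φ n m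

IsOmega : (T S : Pred) → (Branch T → Branch S) → (ℕ → ℕ) → Set
IsOmega T S Φ Ω = ∀ (n : ℕ) → IsModulus T S Φ n (Ω n)
                        × (∀ (m : ℕ) → IsModulus T S Φ n m → Ω n ≤ m)

IsUniformHomeo : (T S : Pred) → (Branch T → Branch S) → (Branch S → Branch T) → Set
IsUniformHomeo T S Φ Ψ =
  (∀ (x : Branch T) → BranchEq T (Ψ (Φ x)) x) × (∀ (y : Branch S) → BranchEq S (Φ (Ψ y)) y)
  × UniformlyContinuous T S Φ × UniformlyContinuous S T Ψ

Monotone : (ℕ → ℕ) → Set
Monotone f = ∀ (n m : ℕ) → n ≤ m → f n ≤ f m

Unbounded : (ℕ → ℕ) → Set
Unbounded f = ¬ (∃[ b ] (∀ (n : ℕ) → f n ≤ b))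

-- If Ω_Φ were bounded by b, every coordinate of Φ(x) would depend only on x ↾ b;
-- as Φ is injective, x ↦ x ↾ b would then inject [T] into the countable set ℕ^{<ℕ}.
-- Monotonicity holds because a modulus for n also serves every smaller n.
{-# OPTIONS --safe #-}
module Submission where

open import Defs
open import Data.Nat using (ℕ; zero; suc; _≤_; _≤′_; ≤′-refl; ≤′-step)
open import Data.Nat.Properties using (≤⇒≤′)
open import Data.Nat.Binary using (ℕᵇ; 2[1+_]; 1+[2_]; toℕ)
  renaming (zero to zeroᵇ)
open import Data.Nat.Binary.Properties using (toℕ-injective; 2[1+_]-injective; 1+[2_]-injective)
open import Data.List using (List; []; _∷_; [_]; _∷ʳ_; map; upTo)
open import Data.List.Properties using (map-++; upTo-∷ʳ; map-cong; ∷ʳ-injective)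
open import Data.Product using (_×_; _,_; proj₁; proj₂)
open import Function using (_∘_)
open import Relation.Binary.PropositionalEquality using (_≡_; refl; sym; trans; cong; cong₂)

↾-suc : (x : ℕ → ℕ) (n : ℕ) → x ↾ suc n ≡ x ↾ n ∷ʳ x n
↾-suc x n = trans (cong (map x) (sym (upTo-∷ʳ n))) (map-++ x (upTo n) [ n ])

↾-suc-injective : ∀ {x y : ℕ → ℕ} n → x ↾ suc n ≡ y ↾ suc n → x ↾ n ≡ y ↾ n × x n ≡ y n
↾-suc-injective {x} {y} n eq =
  ∷ʳ-injective (x ↾ n) (y ↾ n) (trans (sym (↾-suc x n)) (trans eq (↾-suc y n)))

↾-restrict : ∀ {x y : ℕ → ℕ} {m n} → m ≤′ n → x ↾ n ≡ y ↾ n → x ↾ m ≡ y ↾ m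
↾-restrict ≤′-refl                 eq = eq
↾-restrict (≤′-step {n = n} m≤′n) eq = ↾-restrict m≤′n (proj₁ (↾-suc-injective n eq))

↾-cong : ∀ {x y : ℕ → ℕ} → (∀ i → x i ≡ y i) → ∀ n → x ↾ n ≡ y ↾ n
↾-cong x≗y n = map-cong x≗y (upTo n)

-- ℕ^{<ℕ} ↪ ℕ factors through ℕᵇ, whose constructors give each number a unique
-- form, so codes built from them are injective by constructor injectivity.

pushᵇ : ℕ → ℕᵇ → ℕᵇ
pushᵇ zero    c = 1+[2 c ]
pushᵇ (suc a) c = 2[1+ pushᵇ a c ]

pushᵇ-injective : ∀ a b {c d} → pushᵇ a c ≡ pushᵇ b d → a ≡ b × c ≡ d
pushᵇ-injective zero    zero    eq = refl , 1+[2_]-injective eq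
pushᵇ-injective (suc a) (suc b) eq with pushᵇ-injective a b (2[1+_]-injective eq)
... | refl , c≡d = refl , c≡d
pushᵇ-injective zero    (suc b) ()
pushᵇ-injective (suc a) zero    ()

listCodeᵇ : List ℕ → ℕᵇ
listCodeᵇ []      = zeroᵇ
listCodeᵇ (a ∷ l) = pushᵇ a (listCodeᵇ l)

listCodeᵇ-injective : ∀ k l → listCodeᵇ k ≡ listCodeᵇ l → k ≡ l
listCodeᵇ-injective []      []      _  = refl
listCodeᵇ-injective (a ∷ k) (b ∷ l) eq with pushᵇ-injective a b eq
... | a≡b , codes≡ = cong₂ _∷_ a≡b (listCodeᵇ-injective k l codes≡)
listCodeᵇ-injective []      (zero  ∷ _) ()
listCodeᵇ-injective []      (suc _ ∷ _) ()
listCodeᵇ-injective (zero  ∷ _) [] ()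
listCodeᵇ-injective (suc _ ∷ _) [] ()

listCode : List ℕ → ℕ
listCode = toℕ ∘ listCodeᵇ

listCode-injective : ∀ k l → listCode k ≡ listCode l → k ≡ l
listCode-injective k l = listCodeᵇ-injective k l ∘ toℕ-injective

prefix-determines⇒Countable : (T : Pred) (b : ℕ)
  → (∀ (x y : Branch T) → proj₁ x ↾ b ≡ proj₁ y ↾ b → BranchEq T x y)
  → Countable T
prefix-determines⇒Countable T b determines =
  (λ x → listCode (proj₁ x ↾ b)) ,
  (λ x y → determines x y ∘ listCode-injective (proj₁ x ↾ b) (proj₁ y ↾ b))

-- Branches are compared pointwise, so without function extensionality even
-- a function of branches need not respect BranchEq; continuity ensures it.
UniformlyContinuous⇒respects-BranchEq : (T S : Pred) (Φ : Branch T → Branch S)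
  → UniformlyContinuous T S Φ → ∀ x y → BranchEq T x y → BranchEq S (Φ x) (Φ y)
UniformlyContinuous⇒respects-BranchEq T S Φ uc x y x≗y i =
  proj₂ (↾-suc-injective i (proj₂ (uc (suc i)) x y (↾-cong x≗y (proj₁ (uc (suc i))))))

module _ (T S : Pred) (Φ : Branch T → Branch S) where

  IsModulus-antitone : ∀ {n k m} → n ≤ k → IsModulus T S Φ k m → IsModulus T S Φ n m
  IsModulus-antitone n≤k modulus x y eq = ↾-restrict (≤⇒≤′ n≤k) (modulus x y eq)

  IsModulus-monotone : ∀ {n m m′} → m ≤ m′ → IsModulus T S Φ n m → IsModulus T S Φ n m′
  IsModulus-monotone m≤m′ modulus x y eq = modulus x y (↾-restrict (≤⇒≤′ m≤m′) eq)

  Omega-monotone : ∀ {Ω} → IsOmega T S Φ Ω → Monotone Ω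
  Omega-monotone {Ω} isΩ n k n≤k = proj₂ (isΩ n) (Ω k) (IsModulus-antitone n≤k (proj₁ (isΩ k)))

  common-modulus⇒prefix-determines : ∀ {b} → (∀ n → IsModulus T S Φ n b)
    → ∀ x y → proj₁ x ↾ b ≡ proj₁ y ↾ b → BranchEq S (Φ x) (Φ y)
  common-modulus⇒prefix-determines modulus x y eq i =
    proj₂ (↾-suc-injective i (modulus (suc i) x y eq))

  Omega-unbounded : (Ψ : Branch S → Branch T) → (∀ x → BranchEq T (Ψ (Φ x)) x)
    → UniformlyContinuous S T Ψ → Uncountable T
    → ∀ {Ω} → IsOmega T S Φ Ω → Unbounded Ω
  Omega-unbounded Ψ ΨΦ≗id ucΨ uncountable {Ω} isΩ (b , Ω≤b) =
    uncountable (prefix-determines⇒Countable T b prefix-determines)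
    where
    prefix-determines : ∀ x y → proj₁ x ↾ b ≡ proj₁ y ↾ b → BranchEq T x y
    prefix-determines x y eq i = trans (sym (ΨΦ≗id x i)) (trans (ΨΦx≗ΨΦy i) (ΨΦ≗id y i))
      where
      Φx≗Φy : BranchEq S (Φ x) (Φ y)
      Φx≗Φy = common-modulus⇒prefix-determines
        (λ n → IsModulus-monotone (Ω≤b n) (proj₁ (isΩ n))) x y eq
      ΨΦx≗ΨΦy : BranchEq T (Ψ (Φ x)) (Ψ (Φ y))
      ΨΦx≗ΨΦy = UniformlyContinuous⇒respects-BranchEq S T Ψ ucΨ (Φ x) (Φ y) Φx≗Φy

lemma2p6 : (T S : Pred) → IsTree T → IsTree S → Pruned T → Pruned S
           → (Φ : Branch T → Branch S) → (Ψ : Branch S → Branch T)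
           → IsUniformHomeo T S Φ Ψ
           → Uncountable T → Uncountable S
           → (Ω Ω′ : ℕ → ℕ) → IsOmega T S Φ Ω → IsOmega S T Ψ Ω′
           → (Monotone Ω × Unbounded Ω) × (Monotone Ω′ × Unbounded Ω′)
lemma2p6 T S _ _ _ _ Φ Ψ (ΨΦ≗id , ΦΨ≗id , ucΦ , ucΨ) uncountableT uncountableS _ _ isΩ isΩ′ =
  (Omega-monotone T S Φ isΩ , Omega-unbounded T S Φ Ψ ΨΦ≗id ucΨ uncountableT isΩ) ,
  (Omega-monotone S T Ψ isΩ′ , Omega-unbounded S T Ψ Φ ΦΨ≗id ucΦ uncountableS isΩ′)
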